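{- Let $M=(E,\mathcal{I})$ be a matroid with $r_M(E)\geq 2$, let $t$ be a positive integer, and suppose $E$ is colored so that the number of colors appearing in $E$ satisfies $|c(E)|\geq \max_{F\colon r_M(F)\leq r_M(E)-2}\{|F|+t(r_M(E)-r_M(F)-1)\}+1$, the maximum being over flats $F$ with $r_M(F)\leq r_M(E)-2$. Then for every flat $F$ of $M$: (1) if $r_M(F)\leq r_M(E)-2$, then $|c(E\setminus F)|\geq t\,(r_M(E)-r_M(F)-1)+\eta(F)+\xi(F)+1$; (2) if $r_M(F)=r_M(E)-1$ and $|c(E)|>|F|$, then $|c(E\setminus F)|\geq \eta(F)+\xi(F)+1$.
   Context: All matroids have finite ground sets; $r_M(S)$ is the rank of $S\subseteq E$; a flat is a set $F$ with $cl(F)=F$, where $cl(S)=\{x\in E: r_M(S\cup\{x\})=r_M(S)\}$. For $S\subseteq E$, $c(S)$ is the set of colors appearing on elements of $S$. For a set $F\subseteq E$, $\eta(F):=|F|-|c(F)|$ and $\xi(F):=|c(F)\cap c(E\setminus F)|$. -}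

module Defs where

open import Data.Nat using (ℕ; zero; suc; _+_; _*_; _∸_; _⊔_; _<_)
open import Data.Bool using (Bool; true; false; _∧_; _∨_; if_then_else_)
open import Data.Fin using (Fin; _≟_)
open import Data.Fin.Subset using (Subset; _∈_; _∉_; _⊆_; _∪_; _∩_; ⁅_⁆; ∁; ∣_∣; ⊥)
open import Data.Fin.Subset.Properties using (_⊆?_)
open import Data.List using (List; []; _∷_; map; _++_; foldr; allFin)
open import Data.Bool.ListAction using (any)
open import Data.Vec using (Vec; []; _∷_; tabulate; lookup)
open import Data.Product using (∃; _×_)
open import Relation.Nullary using (Dec; ¬_)
open import Relation.Nullary.Decidable using (⌊_⌋)
open import Relation.Binary.PropositionalEquality using (_≡_)
open import Function.Bundles using (_⇔_)

record Matroid (n : ℕ) : Set₁ where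
  field
    Indep     : Subset n → Set
    Indep?    : (I : Subset n) → Dec (Indep I)
    indep-⊥   : Indep ⊥
    indep-⊆   : ∀ {I J} → J ⊆ I → Indep I → Indep J
    exchange  : ∀ {I J} → Indep I → Indep J → ∣ I ∣ < ∣ J ∣ →
                ∃ λ x → x ∈ J × x ∉ I × Indep (I ∪ ⁅ x ⁆)

allSubsets : (n : ℕ) → List (Subset n)
allSubsets zero = [] ∷ []
allSubsets (suc n) = map (true ∷_) (allSubsets n) ++ map (false ∷_) (allSubsets n)

rank : ∀ {n} → Matroid n → Subset n → ℕ
rank {n} M S = foldr _⊔_ 0 (map val (allSubsets n))
  where
  open Matroid M
  val : Subset n → ℕ
  val T = if ⌊ Indep? T ⌋ ∧ ⌊ T ⊆? S ⌋ then ∣ T ∣ else 0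

E : ∀ {n} → Subset n
E = tabulate (λ _ → true)

-- F is a flat: cl(F) = F, where cl(S) = {x : r(S ∪ {x}) = r(S)}
IsFlat : ∀ {n} → Matroid n → Subset n → Set
IsFlat M F = ∀ x → (x ∈ F ⇔ rank M (F ∪ ⁅ x ⁆) ≡ rank M F)

colors : ∀ {n m} → (Fin n → Fin m) → Subset n → Subset m
colors {n} c S = tabulate (λ j → any (λ i → lookup S i ∧ ⌊ c i ≟ j ⌋) (allFin n))

-- η(F) = |F| - |c(F)|   (always ≥ 0, so ∸ is exact)
η : ∀ {n m} → (Fin n → Fin m) → Subset n → ℕ
η c F = ∣ F ∣ ∸ ∣ colors c F ∣

ξ : ∀ {n m} → (Fin n → Fin m) → Subset n → ℕ
ξ c F = ∣ colors c F ∩ colors c (∁ F) ∣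

{-# OPTIONS --safe #-}
module Submission where

-- Only the colouring matters: the colours of E split as c(E) = c(F) ∪ c(E∖F), and the
-- two parts overlap in exactly ξ(F) colours, so |c(E)| + ξ(F) = |c(F)| + |c(E∖F)|.
-- Writing |c(F)| = |F| − η(F) turns this into |c(E∖F)| = |c(E)| − |F| + η(F) + ξ(F),
-- and the hypothesis on |c(E)| (or |c(E)| > |F| in case (2)) gives the bound.

open import Defs
open import Algebra.Bundles using (CommutativeMonoid)
open import Algebra.Properties.CommutativeSemigroup using (interchange)
open import Data.Bool using (Bool; true; false; _∧_; _∨_; not)
open import Data.Bool.ListAction using (any; or)
open import Data.Bool.Properties using (∨-identityʳ; ∨-commutativeMonoid)
open import Data.Fin using (Fin; zero; suc; _≟_)
open import Data.Fin.Properties using (suc-injective)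
open import Data.Fin.Subset using (Subset; ∁; ∣_∣; _∪_; _∩_; ⁅_⁆; ⊥)
open import Data.Fin.Subset.Properties using (∣⁅x⁆∣≡1; ∣⊥∣≡0)
open import Data.List using (List; []; _∷_; allFin)
open import Data.List.Properties using (map-tabulate; map-cong)
open import Data.Nat using (ℕ; suc; _+_; _*_; _∸_; _≤_; _<_; s≤s)
open import Data.Nat.Properties
  using (+-suc; +-comm; +-identityʳ; m≤m+n; ≤-reflexive; m∸n+n≡m; +-cancelˡ-≤; +-monoˡ-≤; module ≤-Reasoning)
open import Data.Nat.Tactic.RingSolver using (solve-∀)
open import Data.Product using (_×_; _,_)
open import Data.Vec using ([]; _∷_; lookup)
open import Data.Vec.Properties using (lookup∘tabulate; lookup-zipWith; lookup-map; lookup-replicate)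
open import Data.Vec.Relation.Binary.Pointwise.Extensional using (ext; Pointwise-≡⇒≡)
open import Function using (id; _∘_)
open import Relation.Nullary.Decidable using (⌊_⌋; ⌊⌋-map′)
open import Relation.Binary.PropositionalEquality

any-∨ : ∀ {A : Set} (p q : A → Bool) (xs : List A) →
        any (λ x → p x ∨ q x) xs ≡ any p xs ∨ any q xs
any-∨ p q []       = refl
any-∨ p q (x ∷ xs) =
  trans (cong ((p x ∨ q x) ∨_) (any-∨ p q xs))
        (interchange (CommutativeMonoid.commutativeSemigroup ∨-commutativeMonoid)
                     (p x) (q x) (any p xs) (any q xs))

any-allFin-suc : ∀ {n} (p : Fin (suc n) → Bool) →
                 any p (allFin (suc n)) ≡ p zero ∨ any (p ∘ suc) (allFin n)
any-allFin-suc p =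
  cong (λ bs → p zero ∨ or bs)
       (trans (map-tabulate suc p) (sym (map-tabulate id (p ∘ suc))))

∣p∪q∣+∣p∩q∣≡∣p∣+∣q∣ : ∀ {n} (p q : Subset n) → ∣ p ∪ q ∣ + ∣ p ∩ q ∣ ≡ ∣ p ∣ + ∣ q ∣
∣p∪q∣+∣p∩q∣≡∣p∣+∣q∣ []          []          = refl
∣p∪q∣+∣p∩q∣≡∣p∣+∣q∣ (true ∷ p)  (true ∷ q)  = cong suc (begin
  ∣ p ∪ q ∣ + suc ∣ p ∩ q ∣  ≡⟨ +-suc _ _ ⟩
  suc (∣ p ∪ q ∣ + ∣ p ∩ q ∣) ≡⟨ cong suc (∣p∪q∣+∣p∩q∣≡∣p∣+∣q∣ p q) ⟩
  suc (∣ p ∣ + ∣ q ∣)         ≡⟨ +-suc _ _ ⟨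
  ∣ p ∣ + suc ∣ q ∣           ∎)
  where open ≡-Reasoning
∣p∪q∣+∣p∩q∣≡∣p∣+∣q∣ (true ∷ p)  (false ∷ q) = cong suc (∣p∪q∣+∣p∩q∣≡∣p∣+∣q∣ p q)
∣p∪q∣+∣p∩q∣≡∣p∣+∣q∣ (false ∷ p) (true ∷ q)  =
  trans (cong suc (∣p∪q∣+∣p∩q∣≡∣p∣+∣q∣ p q)) (sym (+-suc _ _))
∣p∪q∣+∣p∩q∣≡∣p∣+∣q∣ (false ∷ p) (false ∷ q) = ∣p∪q∣+∣p∩q∣≡∣p∣+∣q∣ p q

∣p∪q∣≤∣p∣+∣q∣ : ∀ {n} (p q : Subset n) → ∣ p ∪ q ∣ ≤ ∣ p ∣ + ∣ q ∣
∣p∪q∣≤∣p∣+∣q∣ p q = subst (∣ p ∪ q ∣ ≤_) (∣p∪q∣+∣p∩q∣≡∣p∣+∣q∣ p q) (m≤m+n _ _)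

lookup-⁅x⁆ : ∀ {n} (x j : Fin n) → lookup ⁅ x ⁆ j ≡ ⌊ x ≟ j ⌋
lookup-⁅x⁆ zero    zero    = refl
lookup-⁅x⁆ zero    (suc j) = lookup-replicate j false
lookup-⁅x⁆ (suc x) zero    = refl
lookup-⁅x⁆ (suc x) (suc j) =
  trans (lookup-⁅x⁆ x j) (sym (⌊⌋-map′ (cong suc) suc-injective (x ≟ j)))

lookup-colors : ∀ {n m} (c : Fin n → Fin m) S j →
  lookup (colors c S) j ≡ any (λ i → lookup S i ∧ ⌊ c i ≟ j ⌋) (allFin n)
lookup-colors c S j = lookup∘tabulate _ j

colors-E≡colors∪colors∁ : ∀ {n m} (c : Fin n → Fin m) F →
  colors c E ≡ colors c F ∪ colors c (∁ F)
colors-E≡colors∪colors∁ {n} c F = Pointwise-≡⇒≡ (ext λ j → begin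
    lookup (colors c E) j
  ≡⟨ lookup-colors c E j ⟩
    any (λ i → lookup E i ∧ ⌊ c i ≟ j ⌋) (allFin n)
  ≡⟨ cong or (map-cong (λ i → split (lookup∘tabulate _ i) (lookup-map i not F)) (allFin n)) ⟩
    any (λ i → (lookup F i ∧ ⌊ c i ≟ j ⌋) ∨ (lookup (∁ F) i ∧ ⌊ c i ≟ j ⌋)) (allFin n)
  ≡⟨ any-∨ _ _ (allFin n) ⟩
    any (λ i → lookup F i ∧ ⌊ c i ≟ j ⌋) (allFin n) ∨ any (λ i → lookup (∁ F) i ∧ ⌊ c i ≟ j ⌋) (allFin n)
  ≡⟨ cong₂ _∨_ (lookup-colors c F j) (lookup-colors c (∁ F) j) ⟨
    lookup (colors c F) j ∨ lookup (colors c (∁ F)) j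
  ≡⟨ lookup-zipWith _∨_ j (colors c F) (colors c (∁ F)) ⟨
    lookup (colors c F ∪ colors c (∁ F)) j ∎)
  where
  open ≡-Reasoning
  split : ∀ {e f f̅ d} → e ≡ true → f̅ ≡ not f → e ∧ d ≡ (f ∧ d) ∨ (f̅ ∧ d)
  split {f = true}  refl refl = sym (∨-identityʳ _)
  split {f = false} refl refl = refl

∣colors-E∣+ξ≡∣colors∣+∣colors∁∣ : ∀ {n m} (c : Fin n → Fin m) F →
  ∣ colors c E ∣ + ξ c F ≡ ∣ colors c F ∣ + ∣ colors c (∁ F) ∣
∣colors-E∣+ξ≡∣colors∣+∣colors∁∣ c F =
  trans (cong (λ C → ∣ C ∣ + ξ c F) (colors-E≡colors∪colors∁ c F))
        (∣p∪q∣+∣p∩q∣≡∣p∣+∣q∣ (colors c F) (colors c (∁ F)))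

colors-[] : ∀ {m} (c : Fin 0 → Fin m) → colors c [] ≡ ⊥
colors-[] c = Pointwise-≡⇒≡ (ext λ j →
  trans (lookup-colors c [] j) (sym (lookup-replicate j false)))

lookup-colors-∷ : ∀ {n m} (c : Fin (suc n) → Fin m) b S j →
  lookup (colors c (b ∷ S)) j ≡ (b ∧ ⌊ c zero ≟ j ⌋) ∨ lookup (colors (c ∘ suc) S) j
lookup-colors-∷ c b S j =
  trans (lookup-colors c (b ∷ S) j)
        (trans (any-allFin-suc (λ i → lookup (b ∷ S) i ∧ ⌊ c i ≟ j ⌋))
               (cong (_ ∨_) (sym (lookup-colors (c ∘ suc) S j))))

colors-false∷ : ∀ {n m} (c : Fin (suc n) → Fin m) S →
  colors c (false ∷ S) ≡ colors (c ∘ suc) S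
colors-false∷ c S = Pointwise-≡⇒≡ (ext (lookup-colors-∷ c false S))

colors-true∷ : ∀ {n m} (c : Fin (suc n) → Fin m) S →
  colors c (true ∷ S) ≡ ⁅ c zero ⁆ ∪ colors (c ∘ suc) S
colors-true∷ c S = Pointwise-≡⇒≡ (ext λ j →
  trans (lookup-colors-∷ c true S j)
        (sym (trans (lookup-zipWith _∨_ j ⁅ c zero ⁆ (colors (c ∘ suc) S))
                    (cong (_∨ lookup (colors (c ∘ suc) S) j) (lookup-⁅x⁆ (c zero) j)))))

∣colors∣≤∣∣ : ∀ {n m} (c : Fin n → Fin m) S → ∣ colors c S ∣ ≤ ∣ S ∣
∣colors∣≤∣∣ {m = m} c [] = ≤-reflexive (trans (cong ∣_∣ (colors-[] c)) (∣⊥∣≡0 m))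
∣colors∣≤∣∣ c (false ∷ S) =
  subst (λ C → ∣ C ∣ ≤ ∣ S ∣) (sym (colors-false∷ c S)) (∣colors∣≤∣∣ (c ∘ suc) S)
∣colors∣≤∣∣ c (true ∷ S) = begin
  ∣ colors c (true ∷ S) ∣               ≡⟨ cong ∣_∣ (colors-true∷ c S) ⟩
  ∣ ⁅ c zero ⁆ ∪ colors (c ∘ suc) S ∣       ≤⟨ ∣p∪q∣≤∣p∣+∣q∣ ⁅ c zero ⁆ (colors (c ∘ suc) S) ⟩
  ∣ ⁅ c zero ⁆ ∣ + ∣ colors (c ∘ suc) S ∣   ≡⟨ cong (_+ ∣ colors (c ∘ suc) S ∣) (∣⁅x⁆∣≡1 (c zero)) ⟩
  suc ∣ colors (c ∘ suc) S ∣                ≤⟨ s≤s (∣colors∣≤∣∣ (c ∘ suc) S) ⟩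
  suc ∣ S ∣                                 ∎
  where open ≤-Reasoning

∣colors∁∣-lowerBound : ∀ {n m} (c : Fin n → Fin m) F T →
  ∣ F ∣ + T + 1 ≤ ∣ colors c E ∣ → T + η c F + ξ c F + 1 ≤ ∣ colors c (∁ F) ∣
∣colors∁∣-lowerBound c F T bound = +-cancelˡ-≤ ∣ colors c F ∣ _ _ (begin
  ∣ colors c F ∣ + (T + η c F + ξ c F + 1)  ≡⟨ shuffle ∣ colors c F ∣ T (η c F) (ξ c F) ⟩
  η c F + ∣ colors c F ∣ + T + 1 + ξ c F    ≡⟨ cong (λ k → k + T + 1 + ξ c F) (m∸n+n≡m (∣colors∣≤∣∣ c F)) ⟩
  ∣ F ∣ + T + 1 + ξ c F                     ≤⟨ +-monoˡ-≤ (ξ c F) bound ⟩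
  ∣ colors c E ∣ + ξ c F                    ≡⟨ ∣colors-E∣+ξ≡∣colors∣+∣colors∁∣ c F ⟩
  ∣ colors c F ∣ + ∣ colors c (∁ F) ∣       ∎)
  where
  open ≤-Reasoning
  shuffle : ∀ a t e x → a + (t + e + x + 1) ≡ e + a + t + 1 + x
  shuffle = solve-∀

corollary11 : ∀ {n m} (M : Matroid n) (t : ℕ) (c : Fin n → Fin m) →
    2 ≤ rank M E →
    1 ≤ t →
    (∀ F → IsFlat M F → rank M F + 2 ≤ rank M E →
      ∣ F ∣ + t * (rank M E ∸ rank M F ∸ 1) + 1 ≤ ∣ colors c E ∣) →
    ∀ F → IsFlat M F →
      ((rank M F + 2 ≤ rank M E →
         t * (rank M E ∸ rank M F ∸ 1) + η c F + ξ c F + 1 ≤ ∣ colors c (∁ F) ∣)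
      × (rank M F + 1 ≡ rank M E → ∣ F ∣ < ∣ colors c E ∣ →
         η c F + ξ c F + 1 ≤ ∣ colors c (∁ F) ∣))
corollary11 M t c _ _ colorBound F isFlat =
    (λ corank≥2 → ∣colors∁∣-lowerBound c F _ (colorBound F isFlat corank≥2))
  , (λ _ ∣F∣<∣cE∣ →
      ∣colors∁∣-lowerBound c F 0 (subst (_≤ ∣ colors c E ∣) 1+∣F∣≡∣F∣+0+1 ∣F∣<∣cE∣))
  where
  1+∣F∣≡∣F∣+0+1 : suc ∣ F ∣ ≡ ∣ F ∣ + 0 + 1
  1+∣F∣≡∣F∣+0+1 = trans (+-comm 1 ∣ F ∣) (cong (_+ 1) (sym (+-identityʳ ∣ F ∣)))
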